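{- The operations of the Coxeter generators $\sigma_1,\ldots,\sigma_{k-1}$ of $\mathfrak S_k$ on $\Sigma_n(k)$ defined in the context extend to an action of $\mathfrak S_k$ on $\Sigma_n(k)$. Moreover, the map $P:\Sigma_n(k)\to\{1,\ldots,n-1\}^k$ is equivariant and preserves stabilisers: for all $\gamma\in\Sigma_n(k)$ and $\pi\in\mathfrak S_k$, $P(\pi\cdot\gamma)=\pi\cdot P(\gamma)$, and $\pi\cdot P(\gamma)=P(\gamma)$ if and only if $\pi\cdot\gamma=\gamma$.
   Context: Permutations are multiplied with the right factor applied first. $\mathsf T_n$ is the set of transpositions of $\{1,\ldots,n\}$; a transposition is written $(i\,j)$ with $i<j$. For $\sigma\in\mathfrak S_n$, $|\sigma|=n-(\text{number of cycles of }\sigma\text{, fixed points included})$, and $\sigma_1\preccurlyeq\sigma_2$ iff $|\sigma_2|=|\sigma_1|+|\sigma_1^{ -1}\sigma_2|$. $\Sigma_n(k)=\{(\tau_1,\ldots,\tau_k)\in(\mathsf T_n)^k : |\tau_1\cdots\tau_k|=k,\ \tau_1\cdots\tau_k\preccurlyeq(1\,2\,\cdots\,n)\}$. $P$ sends $((i_1\,j_1),\ldots,(i_k\,j_k))$ to $(i_1,\ldots,i_k)$. $\mathfrak S_k$ acts on $\{1,\ldots,n-1\}^k$ by $\pi\cdot(x_1,\ldots,x_k)=(x_{\pi^{ -1}(1)},\ldots,x_{\pi^{ -1}(k)})$. For $l\in\{1,\ldots,k-1\}$, $\sigma_l=(l\;l+1)$ acts on $\gamma=(g_1,\ldots,g_k)=((i_1\,j_1),\ldots,(i_k\,j_k))\in\Sigma_n(k)$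 by: $\sigma_l\cdot\gamma=\gamma$ if $i_l=i_{l+1}$; if $i_l<i_{l+1}$, the consecutive pair $(g_l,g_{l+1})$ is replaced by $(g_{l+1},\,g_{l+1}g_lg_{l+1})$; if $i_l>i_{l+1}$, it is replaced by $(g_lg_{l+1}g_l,\,g_l)$; all other entries unchanged. -}

module Defs where

open import Data.Nat as ℕ using (ℕ; zero; suc; _∸_; _+_)
open import Data.Nat.Properties as ℕP using ()
open import Data.Fin as Fin using (Fin; zero; suc; toℕ; fromℕ; lower₁; inject₁)
open import Data.Fin.Properties as FinP using (toℕ-injective; toℕ-lower₁; toℕ-inject₁; toℕ-fromℕ; toℕ<n; <-cmp)
open import Data.Fin.Permutation as Perm using (Permutation′; _⟨$⟩ʳ_; _⟨$⟩ˡ_; _∘ₚ_; flip; transpose; permutation)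
open import Data.Product using (Σ; _×_; _,_; proj₁; proj₂)
open import Data.Bool using (Bool; true; false; if_then_else_)
open import Data.List as List using (List)
open import Data.Bool.ListAction using (all)
open import Data.Nat.ListAction using (sum)
open import Data.Vec as Vec using (Vec; []; _∷_; lookup; tabulate; _[_]≔_)
open import Data.Vec.Relation.Unary.All using (All)
open import Relation.Binary.PropositionalEquality using (_≡_; refl; sym; trans; cong; _≢_)
open import Relation.Binary.Definitions using (tri<; tri≈; tri>)
open import Relation.Nullary using (yes; no)
open import Relation.Nullary.Negation using (contradiction)

-- Permutations of {1,…,n}, encoded 0-based as bijections of Fin n.

Perm : ℕ → Set
Perm n = Permutation′ n

-- Product with the RIGHT factor applied first:  (π · ρ)(x) = π (ρ x).
-- (stdlib's _∘ₚ_ is diagrammatic: (ρ ∘ₚ π) applies ρ first.)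
_·_ : ∀ {n} → Perm n → Perm n → Perm n
π · ρ = ρ ∘ₚ π

_⁻¹ : ∀ {n} → Perm n → Perm n
π ⁻¹ = flip π

iter : ∀ {A : Set} → (A → A) → ℕ → A → A
iter f zero    x = x
iter f (suc m) x = f (iter f m x)

isOrbitMin : ∀ {n} → Perm n → Fin n → Bool
isOrbitMin {n} σ i = all (λ m → toℕ i ℕ.≤ᵇ toℕ (iter (σ ⟨$⟩ʳ_) m i)) (List.upTo n)

-- number of cycles of σ (fixed points included) = number of orbits
-- = number of elements that are the minimum of their orbit
numCycles : ∀ {n} → Perm n → ℕ
numCycles {n} σ = sum (List.map (λ i → if isOrbitMin σ i then 1 else 0) (List.allFin n))

∣_∣ₚ : ∀ {n} → Perm n → ℕ
∣_∣ₚ {n} σ = n ∸ numCycles σ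

_≼_ : ∀ {n} → Perm n → Perm n → Set
σ₁ ≼ σ₂ = ∣ σ₂ ∣ₚ ≡ ∣ σ₁ ∣ₚ + ∣ (σ₁ ⁻¹) · σ₂ ∣ₚ

-- The long cycle (1 2 ⋯ n): in 0-based form, i ↦ i+1 (mod n).

private
  cyc : ∀ m → Fin (suc m) → Fin (suc m)
  cyc m i with toℕ i ℕ.≟ m
  ... | yes _ = zero
  ... | no ne = suc (lower₁ i (λ e → ne (sym e)))

  cycInv : ∀ m → Fin (suc m) → Fin (suc m)
  cycInv m zero    = fromℕ m
  cycInv m (suc j) = inject₁ j

  cyc-cycInv : ∀ m j → cyc m (cycInv m j) ≡ j
  cyc-cycInv m zero with toℕ (fromℕ m) ℕ.≟ m
  ... | yes _ = refl
  ... | no ne = contradiction (toℕ-fromℕ m) ne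
  cyc-cycInv m (suc j) with toℕ (inject₁ j) ℕ.≟ m
  ... | yes e = contradiction (trans (sym (toℕ-inject₁ j)) e) (ℕP.<⇒≢ (toℕ<n j))
  ... | no ne = cong suc (toℕ-injective (trans (toℕ-lower₁ (inject₁ j) _) (toℕ-inject₁ j)))

  cycInv-cyc : ∀ m i → cycInv m (cyc m i) ≡ i
  cycInv-cyc m i with toℕ i ℕ.≟ m
  ... | yes e = toℕ-injective (trans (toℕ-fromℕ m) (sym e))
  ... | no ne = toℕ-injective (trans (toℕ-inject₁ (lower₁ i _)) (toℕ-lower₁ i _))

longCycle : ∀ n → Perm n
longCycle zero    = Perm.id
longCycle (suc m) = permutation (cyc m) (cycInv m) (cyc-cycInv m) (cycInv-cyc m)

-- Transpositions (i j) with i < j, encoded as pairs (i , j).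

Tr : ℕ → Set
Tr n = Fin n × Fin n

IsTransposition : ∀ {n} → Tr n → Set
IsTransposition (i , j) = i Fin.< j

⟦_⟧ₜ : ∀ {n} → Tr n → Perm n
⟦ (i , j) ⟧ₜ = transpose i j

prod : ∀ {n k} → Vec (Tr n) k → Perm n
prod []       = Perm.id
prod (t ∷ ts) = ⟦ t ⟧ₜ · prod ts

InΣ : ∀ n k → Vec (Tr n) k → Set
InΣ n k γ = All IsTransposition γ × (∣ prod γ ∣ₚ ≡ k) × (prod γ ≼ longCycle n)

Σₙ : ℕ → ℕ → Set
Σₙ n k = Σ (Vec (Tr n) k) (InΣ n k)

P : ∀ {n k} → Vec (Tr n) k → Vec (Fin n) k
P = Vec.map proj₁

_⊙_ : ∀ {A : Set} {k} → Perm k → Vec A k → Vec A k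
π ⊙ x = tabulate (λ a → lookup x (π ⟨$⟩ˡ a))

-- Conjugation of transpositions: s t s for s = (c d), t = (a b) is the
-- transposition (s(a) s(b)), written with the smaller entry first.

sortTr : ∀ {n} → Fin n → Fin n → Tr n
sortTr x y with <-cmp x y
... | tri< _ _ _ = (x , y)
... | tri≈ _ _ _ = (x , y)
... | tri> _ _ _ = (y , x)

conj : ∀ {n} → Tr n → Tr n → Tr n
conj s (a , b) = sortTr (⟦ s ⟧ₜ ⟨$⟩ʳ a) (⟦ s ⟧ₜ ⟨$⟩ʳ b)

-- The operation of the Coxeter generator σ_l = (l l+1) on tuples, where
-- l and l' are the (0-based) positions l and l+1.
coxStep : ∀ {n k} → (l l' : Fin k) → Vec (Tr n) k → Vec (Tr n) k
coxStep l l' γ with <-cmp (proj₁ (lookup γ l)) (proj₁ (lookup γ l'))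
... | tri≈ _ _ _ = γ
... | tri< _ _ _ = (γ [ l ]≔ lookup γ l') [ l' ]≔ conj (lookup γ l') (lookup γ l)
... | tri> _ _ _ = (γ [ l ]≔ conj (lookup γ l) (lookup γ l')) [ l' ]≔ lookup γ l

module Submission where

-- To a tuple γ of transpositions (each written with its
-- smaller point first) we attach invariants: its product, and for every point
-- v the operator conjAbove v γ (conjugation by the entries of γ whose smaller
-- point exceeds v) and the level-v record (the entries with smaller point v,
-- each transported past the later entries of higher level).  Tuples with the
-- same invariants are called equivalent (≋).
--   * The operation of σ_l (a Hurwitz move) yields an equivalent tuple of
--     transpositions and acts on P as σ_l (front-move, coxStep-move); the key
--     identities are the braid relation and the fact that b a b keeps the
--     smaller point of a when a₁ < b₁.
--   * Rigidity: a tuple of transpositions is determined by P and its level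
--     records, so two tuples equivalent to γ with the same P coincide.
--   * Moving entries to the front one by one gives, for every π, an
--     equivalent tuple arrange π γ with P permuted by π.  All axioms of an
--     action, the agreement with σ_l and the stabiliser statement then
--     compare two tuples equivalent to γ with equal P, so follow by rigidity.
-- This works for all tuples of transpositions; Σₙ(k) is preserved because
-- membership only depends on the product, which the invariants include.

open import Defs
open import Data.Nat using (ℕ; suc; zero; _∸_; _+_)
import Data.Nat as ℕ
open import Data.Nat.ListAction using (sum)
open import Data.Fin using (Fin; zero; suc; _<_; toℕ)
open import Data.Fin.Properties using (_≟_; _<?_; <-cmp; <-trans; <-asym; <⇒≢)
import Data.Fin.Permutation
open import Data.Fin.Permutation using (_⟨$⟩ʳ_; _⟨$⟩ˡ_; transpose; _≈_; lift₀-transpose)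
import Data.Fin.Permutation.Components as PC
open import Data.Product using (Σ; _×_; _,_; proj₁; proj₂)
open import Data.Bool using (if_then_else_)
open import Data.Bool.ListAction using (and)
import Data.List as List
open import Data.List using (List; []; _∷_)
import Data.List.Properties as Listₚ
open import Data.Vec as Vec using (Vec; []; _∷_; lookup; tabulate)
open import Data.Vec.Properties using (tabulate∘lookup; lookup∘tabulate; tabulate-cong; removeAt-punchOut; ∷-injective)
open import Data.Vec.Relation.Unary.All using (All; []; _∷_)
open import Data.Empty using (⊥-elim)
open import Relation.Nullary using (Dec; yes; no; does; ¬_)
open import Relation.Nullary.Decidable using (dec-true; dec-false)
open import Relation.Binary.Definitions using (tri<; tri≈; tri>)
open import Relation.Binary.PropositionalEquality
open import Function.Base using (_∘_)
open import Function.Bundles using (_⇔_; mk⇔; Equivalence)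

variable
  n k : ℕ

transpose-matchˡ : (i j : Fin n) {x : Fin n} → x ≡ i → PC.transpose i j x ≡ j
transpose-matchˡ i j refl rewrite dec-true (i ≟ i) refl = refl

transpose-matchʳ : (i j : Fin n) {x : Fin n} → x ≡ j → PC.transpose i j x ≡ i
transpose-matchʳ i j refl with j ≟ i
... | yes j≡i = j≡i
... | no _ rewrite dec-true (j ≟ j) refl = refl

transpose-other : (i j x : Fin n) → x ≢ i → x ≢ j → PC.transpose i j x ≡ x
transpose-other i j x x≢i x≢j rewrite dec-false (x ≟ i) x≢i | dec-false (x ≟ j) x≢j = refl

data Position (i j x : Fin n) : Set where
  at-i      : x ≡ i → Position i j x
  at-j      : x ≡ j → Position i j x
  elsewhere : x ≢ i → x ≢ j → Position i j x

position : (i j x : Fin n) → Position i j x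
position i j x with x ≟ i | x ≟ j
... | yes x≡i | _       = at-i x≡i
... | no _    | yes x≡j = at-j x≡j
... | no x≢i  | no x≢j  = elsewhere x≢i x≢j

transpose-comm : (i j x : Fin n) → PC.transpose i j x ≡ PC.transpose j i x
transpose-comm i j x with position i j x
... | at-i x≡i          = trans (transpose-matchˡ i j x≡i) (sym (transpose-matchʳ j i x≡i))
... | at-j x≡j          = trans (transpose-matchʳ i j x≡j) (sym (transpose-matchˡ j i x≡j))
... | elsewhere x≢i x≢j = trans (transpose-other i j x x≢i x≢j) (sym (transpose-other j i x x≢j x≢i))

involution-move : (f : Fin n → Fin n) → (∀ z → f (f z) ≡ z) → {z w : Fin n} → z ≡ f w → f z ≡ w
involution-move f invol {w = w} z≡fw = trans (cong f z≡fw) (invol w)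

transpose-conj : (f : Fin n → Fin n) → (∀ z → f (f z) ≡ z) → (x y z : Fin n) →
                 PC.transpose (f x) (f y) z ≡ f (PC.transpose x y (f z))
transpose-conj f invol x y z with position (f x) (f y) z
... | at-i z≡fx = trans (transpose-matchˡ (f x) (f y) z≡fx) (cong f (sym (transpose-matchˡ x y (involution-move f invol z≡fx))))
... | at-j z≡fy = trans (transpose-matchʳ (f x) (f y) z≡fy) (cong f (sym (transpose-matchʳ x y (involution-move f invol z≡fy))))
... | elsewhere z≢fx z≢fy = trans (transpose-other (f x) (f y) z z≢fx z≢fy)
      (trans (sym (invol z)) (cong f (sym (transpose-other x y (f z) (z≢fx ∘ moveBack) (z≢fy ∘ moveBack)))))
  where
  moveBack : ∀ {w} → f z ≡ w → z ≡ f w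
  moveBack fz≡w = sym (involution-move f invol (sym fz≡w))

swapₜ : Tr n → Fin n → Fin n
swapₜ t = ⟦ t ⟧ₜ ⟨$⟩ʳ_

swapₜ-involutive : (t : Tr n) (x : Fin n) → swapₜ t (swapₜ t x) ≡ x
swapₜ-involutive (i , j) x = trans (cong (PC.transpose i j) (transpose-comm i j x)) (PC.transpose-inverse i j)

swapₜ-injective : (t : Tr n) {x y : Fin n} → swapₜ t x ≡ swapₜ t y → x ≡ y
swapₜ-injective t {x} {y} eq =
  trans (sym (swapₜ-involutive t x)) (trans (cong (swapₜ t) eq) (swapₜ-involutive t y))

sortTr-< : {x y : Fin n} → x < y → sortTr x y ≡ (x , y)
sortTr-< {x = x} {y} x<y with <-cmp x y
... | tri< _ _ _     = refl
... | tri≈ x≮y _ _   = ⊥-elim (x≮y x<y)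
... | tri> x≮y _ _   = ⊥-elim (x≮y x<y)

sortTr-> : {x y : Fin n} → y < x → sortTr x y ≡ (y , x)
sortTr-> {x = x} {y} y<x with <-cmp x y
... | tri< _ _ y≮x   = ⊥-elim (y≮x y<x)
... | tri≈ _ _ y≮x   = ⊥-elim (y≮x y<x)
... | tri> _ _ _     = refl

sortTr-≡ : {x y : Fin n} → x ≡ y → sortTr x y ≡ (x , y)
sortTr-≡ {x = x} {y} x≡y with <-cmp x y
... | tri< _ x≢y _   = ⊥-elim (x≢y x≡y)
... | tri≈ _ _ _     = refl
... | tri> _ x≢y _   = ⊥-elim (x≢y x≡y)

sortTr-comm : (x y : Fin n) → sortTr x y ≡ sortTr y x
sortTr-comm x y with <-cmp x y
... | tri< x<y _ _   = sym (sortTr-> x<y)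
... | tri≈ _ x≡y _   = sym (trans (sortTr-≡ (sym x≡y)) (cong₂ _,_ (sym x≡y) x≡y))
... | tri> _ _ y<x   = sym (sortTr-< y<x)

sortTr-isTransposition : (x y : Fin n) → x ≢ y → IsTransposition (sortTr x y)
sortTr-isTransposition x y x≢y with <-cmp x y
... | tri< x<y _ _   = x<y
... | tri≈ _ x≡y _   = ⊥-elim (x≢y x≡y)
... | tri> _ _ y<x   = y<x

sortₜ : Tr n → Tr n
sortₜ (x , y) = sortTr x y

sortₜ-transposition : (t : Tr n) → IsTransposition t → sortₜ t ≡ t
sortₜ-transposition t = sortTr-<

sortₜ-sortTr : (x y : Fin n) → sortₜ (sortTr x y) ≡ sortTr x y
sortₜ-sortTr x y with <-cmp x y
... | tri< x<y _ _   = sortTr-< x<y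
... | tri≈ _ x≡y _   = sortTr-≡ x≡y
... | tri> _ _ y<x   = sortTr-< y<x

swapₜ-sortTr : (x y z : Fin n) → swapₜ (sortTr x y) z ≡ PC.transpose x y z
swapₜ-sortTr x y z with <-cmp x y
... | tri< _ _ _     = refl
... | tri≈ _ _ _     = refl
... | tri> _ _ _     = transpose-comm y x z

conj-sortTr : (s : Tr n) (x y : Fin n) → conj s (sortTr x y) ≡ sortTr (swapₜ s x) (swapₜ s y)
conj-sortTr s x y with <-cmp x y
... | tri< _ _ _     = refl
... | tri≈ _ _ _     = refl
... | tri> _ _ _     = sortTr-comm (swapₜ s y) (swapₜ s x)

conj-sortₜ : (s t : Tr n) → conj s (sortₜ t) ≡ conj s t
conj-sortₜ s (x , y) = conj-sortTr s x y

sortₜ-conj : (s t : Tr n) → sortₜ (conj s t) ≡ conj s t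
sortₜ-conj s (x , y) = sortₜ-sortTr (swapₜ s x) (swapₜ s y)

conj-involutive : (s t : Tr n) → conj s (conj s t) ≡ sortₜ t
conj-involutive s (x , y) =
  trans (conj-sortTr s (swapₜ s x) (swapₜ s y)) (cong₂ sortTr (swapₜ-involutive s x) (swapₜ-involutive s y))

swapₜ-conj : (s r : Tr n) (z : Fin n) → swapₜ (conj s r) z ≡ swapₜ s (swapₜ r (swapₜ s z))
swapₜ-conj s (x , y) z =
  trans (swapₜ-sortTr (swapₜ s x) (swapₜ s y) z) (transpose-conj (swapₜ s) (swapₜ-involutive s) x y z)

conj-conj : (s r t : Tr n) → conj (conj s r) t ≡ conj s (conj r (conj s t))
conj-conj s r (x , y) = begin
  conj (conj s r) (x , y)
    ≡⟨ cong₂ sortTr (swapₜ-conj s r x) (swapₜ-conj s r y) ⟩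
  sortTr (swapₜ s (swapₜ r (swapₜ s x))) (swapₜ s (swapₜ r (swapₜ s y)))
    ≡⟨ sym (conj-sortTr s (swapₜ r (swapₜ s x)) (swapₜ r (swapₜ s y))) ⟩
  conj s (sortTr (swapₜ r (swapₜ s x)) (swapₜ r (swapₜ s y)))
    ≡⟨ cong (conj s) (sym (conj-sortTr r (swapₜ s x) (swapₜ s y))) ⟩
  conj s (conj r (conj s (x , y))) ∎
  where open ≡-Reasoning

-- The braid relation behind the Hurwitz move: (b a b)(b t b)(b a b) = b (a t a) b.
conj-braid : (a b t : Tr n) → conj (conj b a) (conj b t) ≡ conj b (conj a t)
conj-braid a b t = begin
  conj (conj b a) (conj b t)            ≡⟨ conj-conj b a (conj b t) ⟩
  conj b (conj a (conj b (conj b t)))   ≡⟨ cong (λ u → conj b (conj a u)) (conj-involutive b t) ⟩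
  conj b (conj a (sortₜ t))             ≡⟨ cong (conj b) (conj-sortₜ a t) ⟩
  conj b (conj a t)                     ∎
  where open ≡-Reasoning

conj-isTransposition : (s t : Tr n) → IsTransposition t → IsTransposition (conj s t)
conj-isTransposition s (x , y) x<y =
  sortTr-isTransposition (swapₜ s x) (swapₜ s y) (λ sx≡sy → <⇒≢ x<y (swapₜ-injective s sx≡sy))

-- If the smaller point of x lies below that of y, conjugating x by y keeps its
-- smaller point: y fixes x₁ and moves x₂ to a point still above x₁.
conj-keeps-smaller : (x y : Tr n) → proj₁ x < proj₁ y → IsTransposition x → IsTransposition y →
                     proj₁ (conj y x) ≡ proj₁ x
conj-keeps-smaller (x₁ , x₂) (y₁ , y₂) x₁<y₁ x₁<x₂ y₁<y₂ =
  cong proj₁ (trans (cong₂ sortTr fixes-x₁ refl) (sortTr-< x₁<image))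
  where
  x₁<y₂ : x₁ < y₂
  x₁<y₂ = <-trans x₁<y₁ y₁<y₂
  fixes-x₁ : PC.transpose y₁ y₂ x₁ ≡ x₁
  fixes-x₁ = transpose-other y₁ y₂ x₁ (<⇒≢ x₁<y₁) (<⇒≢ x₁<y₂)
  x₁<image : x₁ < PC.transpose y₁ y₂ x₂
  x₁<image with position y₁ y₂ x₂
  ... | at-i x₂≡y₁          = subst (x₁ <_) (sym (transpose-matchˡ y₁ y₂ x₂≡y₁)) x₁<y₂
  ... | at-j x₂≡y₂          = subst (x₁ <_) (sym (transpose-matchʳ y₁ y₂ x₂≡y₂)) x₁<y₁
  ... | elsewhere x₂≢y₁ x₂≢y₂ = subst (x₁ <_) (sym (transpose-other y₁ y₂ x₂ x₂≢y₁ x₂≢y₂)) x₁<x₂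

if-holds : {A B : Set} (d : Dec A) {x y : B} → A → (if does d then x else y) ≡ x
if-holds d a rewrite dec-true d a = refl

if-fails : {A B : Set} (d : Dec A) {x y : B} → ¬ A → (if does d then x else y) ≡ y
if-fails d ¬a rewrite dec-false d ¬a = refl

conjAbove : Fin n → Vec (Tr n) k → Tr n → Tr n
conjAbove v []      t = t
conjAbove v (h ∷ γ) t = conjAbove v γ (if does (v <? proj₁ h) then conj h t else t)

conjAbove-over : (v : Fin n) (h : Tr n) (γ : Vec (Tr n) k) (t : Tr n) →
                 v < proj₁ h → conjAbove v (h ∷ γ) t ≡ conjAbove v γ (conj h t)
conjAbove-over v h γ t v<h = cong (conjAbove v γ) (if-holds (v <? proj₁ h) v<h)

conjAbove-skip : (v : Fin n) (h : Tr n) (γ : Vec (Tr n) k) (t : Tr n) →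
                 ¬ v < proj₁ h → conjAbove v (h ∷ γ) t ≡ conjAbove v γ t
conjAbove-skip v h γ t v≮h = cong (conjAbove v γ) (if-fails (v <? proj₁ h) v≮h)

level : Fin n → Vec (Tr n) k → List (Tr n)
level v []      = []
level v (g ∷ γ) = if does (proj₁ g ≟ v) then conjAbove v γ g ∷ level v γ else level v γ

level-here : (v : Fin n) (g : Tr n) (γ : Vec (Tr n) k) →
             proj₁ g ≡ v → level v (g ∷ γ) ≡ conjAbove v γ g ∷ level v γ
level-here v g γ g≡v = if-holds (proj₁ g ≟ v) g≡v

level-skip : (v : Fin n) (g : Tr n) (γ : Vec (Tr n) k) →
             proj₁ g ≢ v → level v (g ∷ γ) ≡ level v γ
level-skip v g γ g≢v = if-fails (proj₁ g ≟ v) g≢v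

-- This is the invariant of
-- the Hurwitz moves, and it is fine enough to recover a tuple from its P.
record _≋_ (α β : Vec (Tr n) k) : Set where
  field
    level-≡     : ∀ v → level v α ≡ level v β
    conjAbove-≡ : ∀ v t → conjAbove v α t ≡ conjAbove v β t
    prod-≈      : prod α ≈ prod β
open _≋_

≋-refl : (α : Vec (Tr n) k) → α ≋ α
≋-refl α = record { level-≡ = λ _ → refl ; conjAbove-≡ = λ _ _ → refl ; prod-≈ = λ _ → refl }

≋-sym : {α β : Vec (Tr n) k} → α ≋ β → β ≋ α
≋-sym α≋β = record
  { level-≡     = λ v → sym (level-≡ α≋β v)
  ; conjAbove-≡ = λ v t → sym (conjAbove-≡ α≋β v t)
  ; prod-≈      = λ z → sym (prod-≈ α≋β z)
  }

≋-trans : {α β γ : Vec (Tr n) k} → α ≋ β → β ≋ γ → α ≋ γ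
≋-trans α≋β β≋γ = record
  { level-≡     = λ v → trans (level-≡ α≋β v) (level-≡ β≋γ v)
  ; conjAbove-≡ = λ v t → trans (conjAbove-≡ α≋β v t) (conjAbove-≡ β≋γ v t)
  ; prod-≈      = λ z → trans (prod-≈ α≋β z) (prod-≈ β≋γ z)
  }

≋-cons : (g : Tr n) {α β : Vec (Tr n) k} → α ≋ β → (g ∷ α) ≋ (g ∷ β)
≋-cons g α≋β = record
  { level-≡     = λ v → cong₂ (λ c l → if does (proj₁ g ≟ v) then c ∷ l else l)
                                (conjAbove-≡ α≋β v g) (level-≡ α≋β v)
  ; conjAbove-≡ = λ v t → conjAbove-≡ α≋β v _
  ; prod-≈      = λ z → cong (swapₜ g) (prod-≈ α≋β z)
  }

-- The Hurwitz move on a pair a, b of transpositions with a₁ < b₁: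
-- (a , b) ↦ (b , b a b).  It preserves the equivalence, one component at a
-- time; throughout, b a b has the same smaller point as a.
module HurwitzMove (a b : Tr n) (δ : Vec (Tr n) k)
                   (a₁<b₁ : proj₁ a < proj₁ b) (a-tr : IsTransposition a) (b-tr : IsTransposition b) where

  c : Tr n
  c = conj b a

  c₁≡a₁ : proj₁ c ≡ proj₁ a
  c₁≡a₁ = conj-keeps-smaller a b a₁<b₁ a-tr b-tr

  level-≡ₕ : (v : Fin n) → level v (b ∷ c ∷ δ) ≡ level v (a ∷ b ∷ δ)
  level-≡ₕ v with position (proj₁ a) (proj₁ b) v
  ... | at-i v≡a₁ = begin
    level v (b ∷ c ∷ δ)                    ≡⟨ level-skip v b (c ∷ δ) b₁≢v ⟩
    level v (c ∷ δ)                        ≡⟨ level-here v c δ (trans c₁≡a₁ (sym v≡a₁)) ⟩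
    conjAbove v δ c ∷ level v δ            ≡⟨ cong₂ _∷_ (sym (conjAbove-over v b δ a v<b₁)) (sym (level-skip v b δ b₁≢v)) ⟩
    conjAbove v (b ∷ δ) a ∷ level v (b ∷ δ) ≡⟨ sym (level-here v a (b ∷ δ) (sym v≡a₁)) ⟩
    level v (a ∷ b ∷ δ)                    ∎
    where
    open ≡-Reasoning
    v<b₁ : v < proj₁ b
    v<b₁ = subst (_< proj₁ b) (sym v≡a₁) a₁<b₁
    b₁≢v : proj₁ b ≢ v
    b₁≢v b₁≡v = <⇒≢ v<b₁ (sym b₁≡v)
  ... | at-j v≡b₁ = begin
    level v (b ∷ c ∷ δ)                    ≡⟨ level-here v b (c ∷ δ) (sym v≡b₁) ⟩
    conjAbove v (c ∷ δ) b ∷ level v (c ∷ δ) ≡⟨ cong₂ _∷_ (conjAbove-skip v c δ b v≮c₁) (level-skip v c δ c₁≢v) ⟩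
    conjAbove v δ b ∷ level v δ            ≡⟨ sym (level-here v b δ (sym v≡b₁)) ⟩
    level v (b ∷ δ)                        ≡⟨ sym (level-skip v a (b ∷ δ) a₁≢v) ⟩
    level v (a ∷ b ∷ δ)                    ∎
    where
    open ≡-Reasoning
    c₁<v : proj₁ c < v
    c₁<v = subst₂ _<_ (sym c₁≡a₁) (sym v≡b₁) a₁<b₁
    v≮c₁ : ¬ v < proj₁ c
    v≮c₁ v<c₁ = <-asym v<c₁ c₁<v
    c₁≢v : proj₁ c ≢ v
    c₁≢v = <⇒≢ c₁<v
    a₁≢v : proj₁ a ≢ v
    a₁≢v = subst (_≢ v) c₁≡a₁ c₁≢v
  ... | elsewhere v≢a₁ v≢b₁ = begin
    level v (b ∷ c ∷ δ)  ≡⟨ level-skip v b (c ∷ δ) (v≢b₁ ∘ sym) ⟩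
    level v (c ∷ δ)      ≡⟨ level-skip v c δ (v≢a₁ ∘ sym ∘ trans (sym c₁≡a₁)) ⟩
    level v δ            ≡⟨ sym (level-skip v b δ (v≢b₁ ∘ sym)) ⟩
    level v (b ∷ δ)      ≡⟨ sym (level-skip v a (b ∷ δ) (v≢a₁ ∘ sym)) ⟩
    level v (a ∷ b ∷ δ)  ∎
    where open ≡-Reasoning

  conjAbove-≡ₕ : (v : Fin n) (t : Tr n) → conjAbove v (b ∷ c ∷ δ) t ≡ conjAbove v (a ∷ b ∷ δ) t
  conjAbove-≡ₕ v t with v <? proj₁ a | v <? proj₁ b
  ... | yes v<a₁ | _ = begin
    conjAbove v (b ∷ c ∷ δ) t            ≡⟨ conjAbove-over v b (c ∷ δ) t (<-trans v<a₁ a₁<b₁) ⟩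
    conjAbove v (c ∷ δ) (conj b t)       ≡⟨ conjAbove-over v c δ _ (subst (v <_) (sym c₁≡a₁) v<a₁) ⟩
    conjAbove v δ (conj c (conj b t))    ≡⟨ cong (conjAbove v δ) (conj-braid a b t) ⟩
    conjAbove v δ (conj b (conj a t))    ≡⟨ sym (conjAbove-over v b δ _ (<-trans v<a₁ a₁<b₁)) ⟩
    conjAbove v (b ∷ δ) (conj a t)       ≡⟨ sym (conjAbove-over v a (b ∷ δ) t v<a₁) ⟩
    conjAbove v (a ∷ b ∷ δ) t            ∎
    where open ≡-Reasoning
  ... | no v≮a₁ | yes v<b₁ = begin
    conjAbove v (b ∷ c ∷ δ) t            ≡⟨ conjAbove-over v b (c ∷ δ) t v<b₁ ⟩
    conjAbove v (c ∷ δ) (conj b t)       ≡⟨ conjAbove-skip v c δ _ (v≮a₁ ∘ subst (v <_) c₁≡a₁) ⟩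
    conjAbove v δ (conj b t)             ≡⟨ sym (conjAbove-over v b δ _ v<b₁) ⟩
    conjAbove v (b ∷ δ) t                ≡⟨ sym (conjAbove-skip v a (b ∷ δ) t v≮a₁) ⟩
    conjAbove v (a ∷ b ∷ δ) t            ∎
    where open ≡-Reasoning
  ... | no v≮a₁ | no v≮b₁ = begin
    conjAbove v (b ∷ c ∷ δ) t            ≡⟨ conjAbove-skip v b (c ∷ δ) t v≮b₁ ⟩
    conjAbove v (c ∷ δ) t                ≡⟨ conjAbove-skip v c δ _ (v≮a₁ ∘ subst (v <_) c₁≡a₁) ⟩
    conjAbove v δ t                      ≡⟨ sym (conjAbove-skip v b δ _ v≮b₁) ⟩
    conjAbove v (b ∷ δ) t                ≡⟨ sym (conjAbove-skip v a (b ∷ δ) t v≮a₁) ⟩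
    conjAbove v (a ∷ b ∷ δ) t            ∎
    where open ≡-Reasoning

  prod-≈ₕ : prod (b ∷ c ∷ δ) ≈ prod (a ∷ b ∷ δ)
  prod-≈ₕ z = trans (cong (swapₜ b) (swapₜ-conj b a w)) (swapₜ-involutive b _)
    where
    w : Fin n
    w = prod δ ⟨$⟩ʳ z

  equivalent : (b ∷ c ∷ δ) ≋ (a ∷ b ∷ δ)
  equivalent = record { level-≡ = level-≡ₕ ; conjAbove-≡ = conjAbove-≡ₕ ; prod-≈ = prod-≈ₕ }

-- The mirror Hurwitz move (a , b) ↦ (a b a , a) for b₁ < a₁ is the inverse of
-- the move above applied to (a b a , a), since a (a b a) a = b.
hurwitz-down : (a b : Tr n) (δ : Vec (Tr n) k) → proj₁ b < proj₁ a →
               IsTransposition a → IsTransposition b → (conj a b ∷ a ∷ δ) ≋ (a ∷ b ∷ δ)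
hurwitz-down a b δ b₁<a₁ a-tr b-tr =
  ≋-sym (subst (λ u → (a ∷ u ∷ δ) ≋ (conj a b ∷ a ∷ δ)) undo
               (HurwitzMove.equivalent (conj a b) a δ c₁<a₁ (conj-isTransposition a b b-tr) a-tr))
  where
  c₁<a₁ : proj₁ (conj a b) < proj₁ a
  c₁<a₁ = subst (_< proj₁ a) (sym (conj-keeps-smaller b a b₁<a₁ b-tr a-tr)) b₁<a₁
  undo : conj a (conj a b) ≡ b
  undo = trans (conj-involutive a b) (sortₜ-transposition b b-tr)

front-move : (a b : Tr n) (δ : Vec (Tr n) k) → All IsTransposition (a ∷ b ∷ δ) →
             coxStep zero (suc zero) (a ∷ b ∷ δ) ≋ (a ∷ b ∷ δ)
             × All IsTransposition (coxStep zero (suc zero) (a ∷ b ∷ δ))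
             × P (coxStep zero (suc zero) (a ∷ b ∷ δ)) ≡ proj₁ b ∷ proj₁ a ∷ P δ
front-move a b δ all@(a-tr ∷ b-tr ∷ δ-tr) with <-cmp (proj₁ a) (proj₁ b)
... | tri< a₁<b₁ _ _ =
  HurwitzMove.equivalent a b δ a₁<b₁ a-tr b-tr ,
  b-tr ∷ conj-isTransposition b a a-tr ∷ δ-tr ,
  cong (λ u → proj₁ b ∷ u ∷ P δ) (conj-keeps-smaller a b a₁<b₁ a-tr b-tr)
... | tri≈ _ a₁≡b₁ _ =
  ≋-refl (a ∷ b ∷ δ) , all , cong₂ (λ u w → u ∷ w ∷ P δ) a₁≡b₁ (sym a₁≡b₁)
... | tri> _ _ b₁<a₁ =
  hurwitz-down a b δ b₁<a₁ a-tr b-tr ,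
  conj-isTransposition a b b-tr ∷ a-tr ∷ δ-tr ,
  cong (λ u → u ∷ proj₁ a ∷ P δ) (conj-keeps-smaller b a b₁<a₁ b-tr a-tr)

coxStep-suc : (l l' : Fin k) (g : Tr n) (γ : Vec (Tr n) k) →
              coxStep (suc l) (suc l') (g ∷ γ) ≡ g ∷ coxStep l l' γ
coxStep-suc l l' g γ with <-cmp (proj₁ (lookup γ l)) (proj₁ (lookup γ l'))
... | tri< _ _ _ = refl
... | tri≈ _ _ _ = refl
... | tri> _ _ _ = refl

coxStep-move : (l l' : Fin k) → toℕ l' ≡ suc (toℕ l) → (γ : Vec (Tr n) k) → All IsTransposition γ →
               coxStep l l' γ ≋ γ × All IsTransposition (coxStep l l' γ)
               × P (coxStep l l' γ) ≡ transpose l l' ⊙ P γ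
coxStep-move zero    (suc zero) _ (a ∷ b ∷ δ) all with front-move a b δ all
... | equiv , all′ , P-eq = equiv , all′ , trans P-eq (cong (λ u → proj₁ b ∷ proj₁ a ∷ u) (sym (tabulate∘lookup (P δ))))
coxStep-move (suc l) (suc l') l'≡1+l (g ∷ γ) (g-tr ∷ γ-tr) with coxStep-move l l' (cong ℕ.pred l'≡1+l) γ γ-tr
... | equiv , all′ , P-eq rewrite coxStep-suc l l' g γ =
  ≋-cons g equiv , g-tr ∷ all′ ,
  cong (proj₁ g ∷_) (trans P-eq (tabulate-cong (λ i → cong (lookup (P (g ∷ γ))) (sym (lift₀-transpose l' l (suc i))))))

bring : Fin (suc k) → Vec (Tr n) (suc k) → Vec (Tr n) (suc k)
bring             zero    γ       = γ
bring {k = suc k} (suc j) (g ∷ γ) = coxStep zero (suc zero) (g ∷ bring j γ)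

bring-move : (j : Fin (suc k)) (γ : Vec (Tr n) (suc k)) → All IsTransposition γ →
             bring j γ ≋ γ × All IsTransposition (bring j γ)
             × P (bring j γ) ≡ lookup (P γ) j ∷ Vec.removeAt (P γ) j
bring-move zero    (g ∷ γ) all = ≋-refl (g ∷ γ) , all , refl
bring-move {k = suc k} (suc j) (g ∷ γ@(_ ∷ _)) (g-tr ∷ γ-tr) with bring j γ | bring-move j γ γ-tr
... | h ∷ β | equiv , h-tr ∷ β-tr , P-eq with front-move g h β (g-tr ∷ h-tr ∷ β-tr)
...   | equiv′ , all′ , P-eq′ =
  ≋-trans equiv′ (≋-cons g equiv) , all′ ,
  trans P-eq′ (cong₂ (λ u w → u ∷ proj₁ g ∷ w) (cong Vec.head P-eq) (cong Vec.tail P-eq))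

-- Taking position π⁻¹(0) out of π leaves a permutation of the other k positions.
remainder : Perm (suc k) → Perm k
remainder π = Data.Fin.Permutation.flip (Data.Fin.Permutation.remove zero (Data.Fin.Permutation.flip π))

arrange : Perm k → Vec (Tr n) k → Vec (Tr n) k
arrange {k = zero}  π [] = []
arrange {k = suc k} π γ with bring (π ⟨$⟩ˡ zero) γ
... | h ∷ β = h ∷ arrange (remainder π) β

arrange-move : (π : Perm k) (γ : Vec (Tr n) k) → All IsTransposition γ →
               arrange π γ ≋ γ × All IsTransposition (arrange π γ) × P (arrange π γ) ≡ π ⊙ P γ
arrange-move {k = zero}  π [] [] = ≋-refl [] , [] , refl
arrange-move {k = suc k} π γ all with bring (π ⟨$⟩ˡ zero) γ | bring-move (π ⟨$⟩ˡ zero) γ all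
... | h ∷ β | equiv , h-tr ∷ β-tr , P-eq with arrange-move (remainder π) β β-tr
...   | equiv′ , all′ , P-eq′ =
  ≋-trans (≋-cons h equiv′) equiv , h-tr ∷ all′ ,
  cong₂ _∷_ (cong Vec.head P-eq)
    (trans P-eq′ (trans (cong (remainder π ⊙_) (cong Vec.tail P-eq))
                        (tabulate-cong (λ i → removeAt-punchOut (P γ) _))))

conj-injective : (s x y : Tr n) → conj s x ≡ conj s y → sortₜ x ≡ sortₜ y
conj-injective s x y sxs≡sys =
  trans (sym (conj-involutive s x)) (trans (cong (conj s) sxs≡sys) (conj-involutive s y))

conjAbove-injective : (v : Fin n) (δ : Vec (Tr n) k) (x y : Tr n) →
                      conjAbove v δ x ≡ conjAbove v δ y → sortₜ x ≡ sortₜ y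
conjAbove-injective v []      x y x≡y = cong sortₜ x≡y
conjAbove-injective v (h ∷ δ) x y eq with v <? proj₁ h
... | yes v<h = conj-injective h x y (trans (sym (sortₜ-conj h x)) (trans past (sortₜ-conj h y)))
  where
  past : sortₜ (conj h x) ≡ sortₜ (conj h y)
  past = conjAbove-injective v δ (conj h x) (conj h y)
           (trans (sym (conjAbove-over v h δ x v<h)) (trans eq (conjAbove-over v h δ y v<h)))
... | no v≮h = conjAbove-injective v δ x y
                 (trans (sym (conjAbove-skip v h δ x v≮h)) (trans eq (conjAbove-skip v h δ y v≮h)))

-- Read from the left, the level of the first entry g
-- starts with g transported past the rest, which recovers g.
rigidity : (δ δ′ : Vec (Tr n) k) → All IsTransposition δ → All IsTransposition δ′ →
           P δ ≡ P δ′ → (∀ v → level v δ ≡ level v δ′) → δ ≡ δ′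
rigidity []      []        _              _                _    _        = refl
rigidity (g ∷ δ) (g′ ∷ δ′) (g-tr ∷ δ-tr) (g′-tr ∷ δ′-tr) P-eq level-eq = cong₂ _∷_ g≡g′ δ≡δ′
  where
  g₁≡g′₁ : proj₁ g ≡ proj₁ g′
  g₁≡g′₁ = proj₁ (∷-injective P-eq)

  tail-levels : ∀ v → level v δ ≡ level v δ′
  tail-levels v with proj₁ g ≟ v
  ... | yes g₁≡v = Listₚ.∷-injectiveʳ
          (trans (sym (level-here v g δ g₁≡v)) (trans (level-eq v) (level-here v g′ δ′ (trans (sym g₁≡g′₁) g₁≡v))))
  ... | no g₁≢v  =
          trans (sym (level-skip v g δ g₁≢v)) (trans (level-eq v) (level-skip v g′ δ′ (g₁≢v ∘ trans g₁≡g′₁)))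

  δ≡δ′ : δ ≡ δ′
  δ≡δ′ = rigidity δ δ′ δ-tr δ′-tr (proj₂ (∷-injective P-eq)) tail-levels

  transported : conjAbove (proj₁ g) δ g ≡ conjAbove (proj₁ g) δ g′
  transported = trans (Listₚ.∷-injectiveˡ
    (trans (sym (level-here _ g δ refl)) (trans (level-eq (proj₁ g)) (level-here _ g′ δ′ (sym g₁≡g′₁)))))
    (cong (λ u → conjAbove (proj₁ g) u g′) (sym δ≡δ′))

  g≡g′ : g ≡ g′
  g≡g′ = trans (sym (sortₜ-transposition g g-tr))
           (trans (conjAbove-injective (proj₁ g) δ g g′ transported) (sortₜ-transposition g′ g′-tr))

≋-unique : {δ δ′ γ : Vec (Tr n) k} → All IsTransposition δ → All IsTransposition δ′ →
           δ ≋ γ → δ′ ≋ γ → P δ ≡ P δ′ → δ ≡ δ′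
≋-unique {δ = δ} {δ′} δ-tr δ′-tr δ≋γ δ′≋γ P-eq =
  rigidity δ δ′ δ-tr δ′-tr P-eq (λ v → trans (level-≡ δ≋γ v) (sym (level-≡ δ′≋γ v)))

iter-cong : {A : Set} {f g : A → A} → (∀ x → f x ≡ g x) → ∀ m x → iter f m x ≡ iter g m x
iter-cong f≗g zero    x = refl
iter-cong {f = f} {g} f≗g (suc m) x = trans (cong f (iter-cong f≗g m x)) (f≗g (iter g m x))

size-cong : (σ σ′ : Perm n) → σ ≈ σ′ → ∣ σ ∣ₚ ≡ ∣ σ′ ∣ₚ
size-cong {n = n} σ σ′ σ≈σ′ = cong (λ c → n ∸ c) (cong sum (Listₚ.map-cong counts (List.allFin n)))
  where
  counts : ∀ i → (if isOrbitMin σ i then 1 else 0) ≡ (if isOrbitMin σ′ i then 1 else 0)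
  counts i = cong (λ b → if b then 1 else 0)
    (cong and (Listₚ.map-cong (λ m → cong (λ y → toℕ i ℕ.≤ᵇ toℕ y) (iter-cong σ≈σ′ m i)) (List.upTo n)))

inverse-cong : (σ σ′ : Perm n) → σ ≈ σ′ → ∀ w → σ ⟨$⟩ˡ w ≡ σ′ ⟨$⟩ˡ w
inverse-cong σ σ′ σ≈σ′ w =
  trans (sym (Data.Fin.Permutation.inverseˡ σ′))
        (cong (σ′ ⟨$⟩ˡ_) (trans (sym (σ≈σ′ (σ ⟨$⟩ˡ w))) (Data.Fin.Permutation.inverseʳ σ)))

InΣ-transfer : {δ γ : Vec (Tr n) k} → All IsTransposition δ → prod δ ≈ prod γ → InΣ n k γ → InΣ n k δ
InΣ-transfer {n = n} {δ = δ} {γ} δ-tr prods (_ , size-γ , γ≼cycle) =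
  δ-tr , trans (size-cong (prod δ) (prod γ) prods) size-γ ,
  trans γ≼cycle
    (sym (cong₂ _+_ (size-cong (prod δ) (prod γ) prods) (size-cong ((prod δ ⁻¹) · longCycle n) ((prod γ ⁻¹) · longCycle n) quotients)))
  where
  quotients : (prod δ ⁻¹) · longCycle n ≈ (prod γ ⁻¹) · longCycle n
  quotients z = inverse-cong (prod δ) (prod γ) prods (longCycle n ⟨$⟩ʳ z)

⊙-cong : {A : Set} (π ρ : Perm k) → π ≈ ρ → (x : Vec A k) → π ⊙ x ≡ ρ ⊙ x
⊙-cong π ρ π≈ρ x = tabulate-cong (λ i → cong (lookup x) (inverse-cong π ρ π≈ρ i))

⊙-· : {A : Set} (π ρ : Perm k) (x : Vec A k) → (π · ρ) ⊙ x ≡ π ⊙ (ρ ⊙ x)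
⊙-· π ρ x = tabulate-cong (λ i → sym (lookup∘tabulate _ (π ⟨$⟩ˡ i)))

module _ (π : Perm k) {γ : Vec (Tr n) k} (γ-tr : All IsTransposition γ) where

  arrange-≋ : arrange π γ ≋ γ
  arrange-≋ = proj₁ (arrange-move π γ γ-tr)

  arrange-tr : All IsTransposition (arrange π γ)
  arrange-tr = proj₁ (proj₂ (arrange-move π γ γ-tr))

  arrange-P : P (arrange π γ) ≡ π ⊙ P γ
  arrange-P = proj₂ (proj₂ (arrange-move π γ γ-tr))

-- Each property of the action follows from ≋-unique: both sides are tuples
-- of transpositions equivalent to γ, with the same P.
module _ {γ : Vec (Tr n) k} (γ-tr : All IsTransposition γ) where

  arrange-cong : (π ρ : Perm k) → π ≈ ρ → arrange π γ ≡ arrange ρ γ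
  arrange-cong π ρ π≈ρ = ≋-unique (arrange-tr π γ-tr) (arrange-tr ρ γ-tr) (arrange-≋ π γ-tr) (arrange-≋ ρ γ-tr)
    (trans (arrange-P π γ-tr) (trans (⊙-cong π ρ π≈ρ (P γ)) (sym (arrange-P ρ γ-tr))))

  arrange-stabiliser : (π : Perm k) → (π ⊙ P γ ≡ P γ) ⇔ (arrange π γ ≡ γ)
  arrange-stabiliser π = mk⇔
    (λ πP≡P → ≋-unique (arrange-tr π γ-tr) γ-tr (arrange-≋ π γ-tr) (≋-refl γ) (trans (arrange-P π γ-tr) πP≡P))
    (λ πγ≡γ → trans (sym (arrange-P π γ-tr)) (cong P πγ≡γ))

  arrange-id : arrange Data.Fin.Permutation.id γ ≡ γ
  arrange-id = Equivalence.to (arrange-stabiliser Data.Fin.Permutation.id) (tabulate∘lookup (P γ))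

  arrange-· : (π ρ : Perm k) → arrange (π · ρ) γ ≡ arrange π (arrange ρ γ)
  arrange-· π ρ = ≋-unique (arrange-tr (π · ρ) γ-tr) (arrange-tr π (arrange-tr ρ γ-tr))
    (arrange-≋ (π · ρ) γ-tr) (≋-trans (arrange-≋ π (arrange-tr ρ γ-tr)) (arrange-≋ ρ γ-tr))
    (begin
      P (arrange (π · ρ) γ)          ≡⟨ arrange-P (π · ρ) γ-tr ⟩
      (π · ρ) ⊙ P γ                  ≡⟨ ⊙-· π ρ (P γ) ⟩
      π ⊙ (ρ ⊙ P γ)                  ≡⟨ cong (π ⊙_) (sym (arrange-P ρ γ-tr)) ⟩
      π ⊙ P (arrange ρ γ)            ≡⟨ sym (arrange-P π (arrange-tr ρ γ-tr)) ⟩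
      P (arrange π (arrange ρ γ))    ∎)
    where open ≡-Reasoning

  arrange-coxStep : (l l′ : Fin k) → toℕ l′ ≡ suc (toℕ l) → arrange (transpose l l′) γ ≡ coxStep l l′ γ
  arrange-coxStep l l′ l′≡1+l with coxStep-move l l′ l′≡1+l γ γ-tr
  ... | equiv , all′ , P-eq = ≋-unique (arrange-tr (transpose l l′) γ-tr) all′ (arrange-≋ (transpose l l′) γ-tr) equiv
                                (trans (arrange-P (transpose l l′) γ-tr) (sym P-eq))

act : Perm k → Σₙ n k → Σₙ n k
act π (γ , γ∈Σ) = arrange π γ , InΣ-transfer (arrange-tr π (proj₁ γ∈Σ)) (prod-≈ (arrange-≋ π (proj₁ γ∈Σ))) γ∈Σ

proposition4p2 : (n k : ℕ) →
    Σ (Perm k → Σₙ n k → Σₙ n k) λ act →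
    ((π ρ : Perm k) (γ : Σₙ n k) → (∀ x → π ⟨$⟩ʳ x ≡ ρ ⟨$⟩ʳ x) →
    proj₁ (act π γ) ≡ proj₁ (act ρ γ))
    × ((γ : Σₙ n k) → proj₁ (act Data.Fin.Permutation.id γ) ≡ proj₁ γ)
    × ((π ρ : Perm k) (γ : Σₙ n k) → proj₁ (act (π · ρ) γ) ≡ proj₁ (act π (act ρ γ)))
    × ((l l' : Fin k) → toℕ l' ≡ suc (toℕ l) → (γ : Σₙ n k) →
    proj₁ (act (transpose l l') γ) ≡ coxStep l l' (proj₁ γ))
    × ((π : Perm k) (γ : Σₙ n k) → P (proj₁ (act π γ)) ≡ π ⊙ P (proj₁ γ))
    × ((π : Perm k) (γ : Σₙ n k) → (π ⊙ P (proj₁ γ) ≡ P (proj₁ γ)) ⇔ (proj₁ (act π γ) ≡ proj₁ γ))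
proposition4p2 n k =
  act ,
  (λ π ρ γ π≈ρ → arrange-cong (transpositions γ) π ρ π≈ρ) ,
  (λ γ → arrange-id (transpositions γ)) ,
  (λ π ρ γ → arrange-· (transpositions γ) π ρ) ,
  (λ l l′ l′≡1+l γ → arrange-coxStep (transpositions γ) l l′ l′≡1+l) ,
  (λ π γ → arrange-P π (transpositions γ)) ,
  (λ π γ → arrange-stabiliser (transpositions γ) π)
  where
  transpositions : (γ : Σₙ n k) → All IsTransposition (proj₁ γ)
  transpositions γ = proj₁ (proj₂ γ)
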